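{- In the logic LEL the following are derivable, for all formulas $\phi,\psi$: (A6) $\vdash \phi\leftrightarrow \phi\mathbin{\dot\wedge}\top$; (R11) $\vdash\phi$ if and only if $\vdash\phi\leftrightarrow\top$; (R12) if $\vdash\phi$ and $\vdash\phi\rightarrow\psi$ then $\vdash\psi$; (R13) if $\vdash\phi$ then $\vdash\psi\rightarrow\phi$; (R14) $\vdash\phi\rightarrow\psi$ if and only if $\vdash\phi\rightarrow\phi\wedge\psi$.
   Context: Let $P$ be a set of atomic propositions. Formulas of LEL are given by $\phi::= p\mid\bot\mid\phi\rightarrow\phi$ with $p\in P$. Abbreviations: $\neg\phi:=\phi\rightarrow\bot$; $\top:=\neg\bot$; $\phi\mathbin{\dot\wedge}\psi:=\neg(\phi\rightarrow\neg\psi)$; $\phi\mathbin{\dot\vee}\psi:=\neg(\neg\phi\mathbin{\dot\wedge}\neg\psi)$; $\phi\wedge\psi:=\phi\mathbin{\dot\wedge}(\phi\rightarrow\psi)$; $\phi\vee\psi:=\neg(\neg\phi\wedge\neg\psi)$. "$\vdash\phi\leftrightarrow\psi$" abbreviates "$\vdash\phi\rightarrow\psi$ and $\vdash\psi\rightarrow\phi$". The provable formulas ($\vdash\phi$) form the least set containing all instances of the axiom schemata and closed under the rules below (rules with "iff" apply in both directions): Axioms: (A1) $\vdash\phi\rightarrow\phi$; (A2) $\vdash\phi\leftrightarrow\neg\neg\phi$; (A3) $\vdash\phi\rightarrow\top$; (A4) $\vdash\phi\wedge\psi\rightarrow\phi$; (A5) $\vdash\phi\wedge\psi\rightarrow\psi$.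 Rules: (R1) $\vdash\phi$ iff $\vdash\top\rightarrow\phi$; (R2) $\vdash\phi\rightarrow\psi$ and $\vdash\psi\rightarrow\chi$ imply $\vdash\phi\rightarrow\chi$; (R3) $\vdash\phi\rightarrow\psi$ implies $\vdash\neg\psi\rightarrow\neg\phi$; (R4) $\vdash\phi\rightarrow\psi$ implies $\vdash(\neg\phi\rightarrow\psi)\leftrightarrow(\neg\psi\rightarrow\phi)$; (R5) $\vdash\phi\rightarrow\psi$ implies $\vdash\phi\rightarrow(\neg\phi\rightarrow\psi)$; (R6) $\vdash\phi\rightarrow\psi$ implies $\vdash\chi\mathbin{\dot\wedge}\phi\rightarrow\chi\mathbin{\dot\wedge}\psi$; (R7) $\vdash\phi\leftrightarrow\psi$ implies $\vdash\phi\mathbin{\dot\wedge}\chi\leftrightarrow\psi\mathbin{\dot\wedge}\chi$; (R8) $\vdash\phi\rightarrow\psi$ and $\vdash\phi\rightarrow\chi$ imply $\vdash\phi\rightarrow\psi\wedge\chi$; (R9) $\vdash\phi\rightarrow\neg\psi$, $\vdash\phi\rightarrow\neg\chi$ and $\vdash(\neg\phi\rightarrow\psi)\rightarrow\neg\chi$ imply $\vdash(\neg\phi\rightarrow\chi)\rightarrow\neg\psi$; (R10) $\vdash\neg\psi\rightarrow\chi$ and $\vdash\neg\phi\rightarrow\psi\mathbin{\dot\wedge}\chi$ imply $\vdash\phi\mathbin{\dot\wedge}(\psi\mathbin{\dot\wedge}\chi)\leftrightarrow(\phi\mathbin{\dot\wedge}\psi)\mathbin{\dot\wedge}\chi$.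 -}

module Defs where

open import Level using (Level)
open import Data.Product using (_×_)

data Form {ℓ : Level} (P : Set ℓ) : Set ℓ where
  atom : P → Form P
  ⊥'   : Form P
  _⇒_  : Form P → Form P → Form P

infixr 5 _⇒_
infix 4 _↔'_

module _ {ℓ : Level} {P : Set ℓ} where

  infixr 6 _∧̇_ _∨̇_ _∧'_ _∨'_

  ¬'_ : Form P → Form P
  ¬' φ = φ ⇒ ⊥'

  infix 7 ¬'_

  ⊤' : Form P
  ⊤' = ¬' ⊥'

  _∧̇_ : Form P → Form P → Form P
  φ ∧̇ ψ = ¬' (φ ⇒ ¬' ψ)

  _∨̇_ : Form P → Form P → Form P
  φ ∨̇ ψ = ¬' ((¬' φ) ∧̇ (¬' ψ))

  _∧'_ : Form P → Form P → Form P
  φ ∧' ψ = φ ∧̇ (φ ⇒ ψ)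

  _∨'_ : Form P → Form P → Form P
  φ ∨' ψ = ¬' ((¬' φ) ∧' (¬' ψ))

-- Provability: least set containing the axioms and closed under the rules.
-- "⊢ φ ↔ ψ" abbreviates "⊢ φ → ψ and ⊢ ψ → φ"; rules stated with ↔ as
-- conclusion therefore have two constructors (one per direction), and
-- ↔-hypotheses take both derivations.
data ⊢_ {ℓ : Level} {P : Set ℓ} : Form P → Set ℓ where
  A1  : ∀ φ → ⊢ (φ ⇒ φ)
  A2a : ∀ φ → ⊢ (φ ⇒ ¬' ¬' φ)
  A2b : ∀ φ → ⊢ (¬' ¬' φ ⇒ φ)
  A3  : ∀ φ → ⊢ (φ ⇒ ⊤')
  A4  : ∀ φ ψ → ⊢ ((φ ∧' ψ) ⇒ φ)
  A5  : ∀ φ ψ → ⊢ ((φ ∧' ψ) ⇒ ψ)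
  R1a : ∀ {φ} → ⊢ φ → ⊢ (⊤' ⇒ φ)
  R1b : ∀ {φ} → ⊢ (⊤' ⇒ φ) → ⊢ φ
  R2  : ∀ {φ ψ χ} → ⊢ (φ ⇒ ψ) → ⊢ (ψ ⇒ χ) → ⊢ (φ ⇒ χ)
  R3  : ∀ {φ ψ} → ⊢ (φ ⇒ ψ) → ⊢ (¬' ψ ⇒ ¬' φ)
  R4a : ∀ {φ ψ} → ⊢ (φ ⇒ ψ) → ⊢ ((¬' φ ⇒ ψ) ⇒ (¬' ψ ⇒ φ))
  R4b : ∀ {φ ψ} → ⊢ (φ ⇒ ψ) → ⊢ ((¬' ψ ⇒ φ) ⇒ (¬' φ ⇒ ψ))
  R5  : ∀ {φ ψ} → ⊢ (φ ⇒ ψ) → ⊢ (φ ⇒ (¬' φ ⇒ ψ))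
  R6  : ∀ {φ ψ} χ → ⊢ (φ ⇒ ψ) → ⊢ ((χ ∧̇ φ) ⇒ (χ ∧̇ ψ))
  R7a : ∀ {φ ψ} χ → ⊢ (φ ⇒ ψ) → ⊢ (ψ ⇒ φ) → ⊢ ((φ ∧̇ χ) ⇒ (ψ ∧̇ χ))
  R7b : ∀ {φ ψ} χ → ⊢ (φ ⇒ ψ) → ⊢ (ψ ⇒ φ) → ⊢ ((ψ ∧̇ χ) ⇒ (φ ∧̇ χ))
  R8  : ∀ {φ ψ χ} → ⊢ (φ ⇒ ψ) → ⊢ (φ ⇒ χ) → ⊢ (φ ⇒ (ψ ∧' χ))
  R9  : ∀ {φ ψ χ} → ⊢ (φ ⇒ ¬' ψ) → ⊢ (φ ⇒ ¬' χ) → ⊢ ((¬' φ ⇒ ψ) ⇒ ¬' χ)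
        → ⊢ ((¬' φ ⇒ χ) ⇒ ¬' ψ)
  R10a : ∀ {φ ψ χ} → ⊢ (¬' ψ ⇒ χ) → ⊢ (¬' φ ⇒ (ψ ∧̇ χ))
        → ⊢ ((φ ∧̇ (ψ ∧̇ χ)) ⇒ ((φ ∧̇ ψ) ∧̇ χ))
  R10b : ∀ {φ ψ χ} → ⊢ (¬' ψ ⇒ χ) → ⊢ (¬' φ ⇒ (ψ ∧̇ χ))
        → ⊢ (((φ ∧̇ ψ) ∧̇ χ) ⇒ (φ ∧̇ (ψ ∧̇ χ)))

infix 3 ⊢_

_↔'_ : {ℓ : Level} {P : Set ℓ} → Form P → Form P → Set ℓ
φ ↔' ψ = (⊢ (φ ⇒ ψ)) × (⊢ (ψ ⇒ φ))

module Submission where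

-- Everything rests on rule (R1), which identifies theorems φ with provable
-- implications ⊤ → φ.  This turns a theorem into something that can be
-- composed with (R2), so modus ponens (R12) and weakening (R13) are each a
-- single transitivity step followed, where needed, by (R1) backwards; and
-- (R11) is (R1) together with the axiom (A3) that everything implies ⊤.
-- For (A6) we pass through the "self-conjunction" φ ∧ φ = φ ∧̇ (φ → φ):
-- (R8) yields φ → φ ∧ φ, (A4) yields φ ∧ φ → φ, and monotonicity of ∧̇ in
-- its right argument (R6) trades the second conjunct φ → φ for ⊤, which are
-- interprovable by (A3) and by (R1) applied to (A1).  (R14) is (R8) with
-- (A1) in one direction and (A5) in the other.

open import Defs
open import Level using (Level)
open import Data.Product using (_×_; _,_; proj₂)
open import Function.Bundles using (_⇔_; mk⇔)

module _ {ℓ : Level} {P : Set ℓ} where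

  modus-ponens : (φ ψ : Form P) → ⊢ φ → ⊢ (φ ⇒ ψ) → ⊢ ψ
  modus-ponens φ ψ ⊢φ ⊢φ⇒ψ = R1b (R2 (R1a ⊢φ) ⊢φ⇒ψ)

  weakening : (φ ψ : Form P) → ⊢ φ → ⊢ (ψ ⇒ φ)
  weakening φ ψ ⊢φ = R2 (A3 ψ) (R1a ⊢φ)

  theorem⇔equiv-⊤ : (φ : Form P) → (⊢ φ) ⇔ (φ ↔' ⊤')
  theorem⇔equiv-⊤ φ = mk⇔ (λ ⊢φ → A3 φ , R1a ⊢φ) (λ φ↔⊤ → R1b (proj₂ φ↔⊤))

  -- φ → φ and ⊤ are interprovable, so they may replace each other as the
  -- right conjunct of ∧̇ (R6); this is how ⊤ enters φ ∧ φ = φ ∧̇ (φ → φ).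
  self-conj⇒∧̇⊤ : (φ : Form P) → ⊢ ((φ ∧' φ) ⇒ (φ ∧̇ ⊤'))
  self-conj⇒∧̇⊤ φ = R6 φ (A3 (φ ⇒ φ))

  ∧̇⊤⇒self-conj : (φ : Form P) → ⊢ ((φ ∧̇ ⊤') ⇒ (φ ∧' φ))
  ∧̇⊤⇒self-conj φ = R6 φ (R1a (A1 φ))

  equiv-∧̇⊤ : (φ : Form P) → φ ↔' (φ ∧̇ ⊤')
  equiv-∧̇⊤ φ = R2 (R8 (A1 φ) (A1 φ)) (self-conj⇒∧̇⊤ φ)
              , R2 (∧̇⊤⇒self-conj φ) (A4 φ φ)

  imp⇔imp-conj : (φ ψ : Form P) → (⊢ (φ ⇒ ψ)) ⇔ (⊢ (φ ⇒ (φ ∧' ψ)))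
  imp⇔imp-conj φ ψ = mk⇔ (R8 (A1 φ)) (λ ⊢φ⇒φ∧ψ → R2 ⊢φ⇒φ∧ψ (A5 φ ψ))

mainTheorem6 : {ℓ : Level} {P : Set ℓ}
    → (∀ (φ : Form P) → φ ↔' (φ ∧̇ ⊤'))
    × (∀ (φ : Form P) → (⊢ φ) ⇔ (φ ↔' ⊤'))
    × (∀ (φ ψ : Form P) → ⊢ φ → ⊢ (φ ⇒ ψ) → ⊢ ψ)
    × (∀ (φ ψ : Form P) → ⊢ φ → ⊢ (ψ ⇒ φ))
    × (∀ (φ ψ : Form P) → (⊢ (φ ⇒ ψ)) ⇔ (⊢ (φ ⇒ (φ ∧' ψ))))
mainTheorem6 =
  equiv-∧̇⊤ , theorem⇔equiv-⊤ , modus-ponens , weakening , imp⇔imp-conj
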